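{- Let $\varepsilon\colon X^{\times}_{\mathrm{irr}}\to\mathcal{P}(M)$ be a map such that $\mathcal{N}[\varepsilon]$ is hierarchy-like and such that for every $N=N_m[y]\in\mathcal{N}[\varepsilon]$ and every $y'\in N$ we have $|N_m[y']|\le|N|$. Then $\varepsilon$ is a Fitch map, and it is explained by the $\varepsilon$-tree $\widehat{T}(\varepsilon)$.
   Context: $X$ is a finite nonempty set, $M$ a finite nonempty set of colors, $X^{\times}_{\mathrm{irr}}=\{(x,y)\in X\times X: x\neq y\}$. A phylogenetic tree on $X$ is a rooted tree whose leaves (non-root vertices of degree $1$) form $X$, whose root has degree $\ge2$ and whose non-root inner vertices have degree $\ge3$; it is determined up to isomorphism by its cluster set $\mathcal{C}(T)=\{C_T(v): v\in V(T)\}$, where $C_T(v)$ is the set of leaves descending from $v$, and any hierarchy on $X$ (a hierarchy-like set system containing $X$ and all singletons) is the cluster set of such a tree. A set system is hierarchy-like if any two members $P,Q$ satisfy $P\cap Q\in\{P,Q,\emptyset\}$. An edge-labeled tree $(T,\lambda)$ on $X$ with $M$ is a phylogenetic tree $T$ on $X$ with $\lambda\colon E(T)\to\mathcal{P}(M)$; $e$ is an $m$-edge if $m\in\lambda(e)$. $(T,\lambda)$ explains $\varepsilon$ if for all $(x,y)\in X^{\times}_{\mathrm{irr}}$, $m\in M$: $m\in\varepsilon(x,y)$ iff the path from $\mathrm{lca}(x,y)$ to $y$ contains an $m$-edge; $\varepsilon$ is a Fitch map if some edge-labeled tree explains it. $N_m[y]=\{x\in X\setminus\{y\}: m\notin\varepsilon(x,y)\}\cup\{y\}$,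 $\mathcal{N}[\varepsilon]=\{N_m[y]: y\in X, m\in M\}$. For $\varepsilon$ with $\mathcal{N}[\varepsilon]$ hierarchy-like, the $\varepsilon$-tree $\widehat{T}(\varepsilon)=(T,\lambda)$ is the edge-labeled tree where $T$ is the phylogenetic tree with $\mathcal{C}(T)=\mathcal{N}[\varepsilon]\cup\{X\}\cup\{\{x\}:x\in X\}$ and each edge gets $\lambda(\mathrm{par}(v),v)=\{m\in M: \text{there is } y\in X \text{ with } C_T(v)=N_m[y]\}$. -}

module Defs where

open import Data.Nat using (ℕ; suc; _≤_)
open import Data.Bool using (Bool; true; false; if_then_else_; not)
open import Data.Fin using (Fin; _≟_)
open import Data.Fin.Subset as S using (Subset; _∈_; _∉_; _⊆_; _∩_; ⁅_⁆; ⊤; Nonempty; ∣_∣)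
open import Data.Vec using (lookup; tabulate)
open import Data.Product using (Σ; ∃; ∃-syntax; _×_; _,_)
open import Data.Sum using (_⊎_)
open import Relation.Nullary using (¬_)
open import Relation.Nullary.Decidable using (⌊_⌋)
open import Relation.Binary.PropositionalEquality using (_≡_; _≢_)
open import Function.Bundles using (_⇔_)

-- Conventions: X = Fin (suc n) (nonempty leaf set), M = Fin (suc k) (nonempty colour set).
-- A map ε : X×X_irr → P(M) is given as a function on all pairs; only values
-- at pairs x ≢ y are ever used.
EpsMap : ℕ → ℕ → Set
EpsMap n k = Fin (suc n) → Fin (suc n) → Subset (suc k)

N : ∀ {n k} → EpsMap n k → Fin (suc k) → Fin (suc n) → Subset (suc n)
N ε m y = tabulate λ x → if ⌊ x ≟ y ⌋ then true else not (lookup (ε x y) m)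

-- A rooted phylogenetic tree is represented by its cluster set C(T) (it is
-- determined by it up to isomorphism); vertices = clusters, the edge into a
-- non-root vertex v is identified with its cluster C_T(v), and an edge labelling
-- λ is given by the relation "m ∈ λ(par(v),v)", i.e. Lab (C_T(v)) m.
record EdgeLabeledTree (n k : ℕ) : Set₁ where
  field
    Cl  : Subset (suc n) → Set
    Lab : Subset (suc n) → Fin (suc k) → Set
open EdgeLabeledTree public

HierarchyLike : ∀ {n} → (Subset n → Set) → Set
HierarchyLike {n} F = ∀ P Q → F P → F Q → (P ∩ Q ≡ P) ⊎ (P ∩ Q ≡ Q) ⊎ (P ∩ Q ≡ S.⊥)

-- The cluster set is a hierarchy on X (nonempty clusters, contains X and all
-- singletons), so it is the cluster set of a phylogenetic tree on X.
IsPhyloTree : ∀ {n k} → EdgeLabeledTree n k → Set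
IsPhyloTree T =
  HierarchyLike (Cl T)
  × (∀ C → Cl T C → Nonempty C)
  × Cl T ⊤
  × (∀ x → Cl T ⁅ x ⁆)

IsLca : ∀ {n k} → EdgeLabeledTree n k → Fin (suc n) → Fin (suc n) → Subset (suc n) → Set
IsLca T x y L = Cl T L × x ∈ L × y ∈ L × (∀ C → Cl T C → x ∈ C → y ∈ C → L ⊆ C)

-- The edge (par(v),v) lies on the path from lca(x,y) to y iff
-- y ∈ C_T(v) ⊊ C_T(lca(x,y)).
Explains : ∀ {n k} → EdgeLabeledTree n k → EpsMap n k → Set
Explains T ε = ∀ (x y : Fin _) → x ≢ y → ∀ m →
  ∃[ L ] (IsLca T x y L ×
    ((m ∈ ε x y) ⇔ (∃[ C ] (Cl T C × y ∈ C × C ⊆ L × C ≢ L × Lab T C m))))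

IsFitch : ∀ {n k} → EpsMap n k → Set₁
IsFitch {n} {k} ε = Σ (EdgeLabeledTree n k) λ T → IsPhyloTree T × Explains T ε

NSys : ∀ {n k} → EpsMap n k → Subset (suc n) → Set
NSys ε C = ∃[ y ] ∃[ m ] (C ≡ N ε m y)

εTree : ∀ {n k} → EpsMap n k → EdgeLabeledTree n k
εTree ε = record
  { Cl  = λ C → NSys ε C ⊎ C ≡ ⊤ ⊎ (∃[ x ] C ≡ ⁅ x ⁆)
  ; Lab = λ C m → ∃[ y ] C ≡ N ε m y
  }

{-# OPTIONS --safe #-}
-- Adding X and the singletons to the hierarchy-like system 𝒩[ε] keeps it
-- hierarchy-like, so the ε-tree is a phylogenetic tree, and lca(x,y) is found as
-- the least of its finitely many clusters containing x and y.  For x ≠ y,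
-- x ∈ N_m[y] means m ∉ ε(x,y).  If m ∈ ε(x,y), the m-labelled cluster N_m[y]
-- contains y but not x, so it lies strictly below lca(x,y).  Conversely, if an
-- m-labelled cluster N_m[y′] ∋ y lies strictly below lca(x,y) while m ∉ ε(x,y),
-- then lca(x,y) ⊆ N_m[y], and the size condition gives
-- |N_m[y′]| < |lca(x,y)| ≤ |N_m[y]| ≤ |N_m[y′]|.
module Submission where

open import Defs
open import Data.Nat using (ℕ; _≤_; suc)
open import Data.Nat.Properties using (<-irrefl; module ≤-Reasoning)
open import Data.Bool using (Bool; true; false; if_then_else_; not)
open import Data.Fin using (Fin; zero; _≟_)
open import Data.Fin.Subset as S using (Subset; _∈_; _∉_; _⊆_; _⊂_; _∩_; ⁅_⁆; ⊤; Nonempty; ∣_∣)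
open import Data.Fin.Subset.Properties
  using (_∈?_; ∈⊤; ∉⊥; ⊥⊆; x∈⁅x⁆; x∈⁅y⁆⇒x≡y; ⊆-refl; ⊆-trans; ⊆-reflexive; ⊆-antisym;
         ∩-comm; p∩q⊆p; p∩q⊆q; x∈p∩q⁺; p⊆q⇒∣p∣≤∣q∣; p⊂q⇒∣p∣<∣q∣)
open import Data.Fin.Properties using (any?)
open import Data.Vec using (lookup)
open import Data.Vec.Properties using (lookup∘tabulate; lookup⇒[]=; []=⇒lookup)
open import Data.Product using (∃; ∃-syntax; _×_; _,_)
open import Data.Sum using (_⊎_; inj₁; inj₂)
open import Data.List using (List; []; _∷_; cartesianProduct; allFin)
open import Data.List.Relation.Unary.All as All using (All; []; _∷_)
open import Data.List.Membership.Propositional.Properties using (∈-cartesianProduct⁺; ∈-allFin)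
open import Relation.Nullary using (yes; no; ¬?; contradiction)
open import Relation.Nullary.Decidable using (⌊_⌋; _×-dec_; decidable-stable)
open import Relation.Binary.PropositionalEquality using (_≡_; _≢_; refl; sym; trans; subst; cong)
open import Function.Base using (_∘_)
open import Function.Bundles using (mk⇔)

⊆∧≢⇒⊂ : ∀ {n} {P Q : Subset n} → P ⊆ Q → P ≢ Q → P ⊂ Q
⊆∧≢⇒⊂ {P = P} {Q} P⊆Q P≢Q with any? (λ z → (z ∈? Q) ×-dec ¬? (z ∈? P))
... | yes (z , z∈Q , z∉P) = P⊆Q , z , z∈Q , z∉P
... | no ∄z = contradiction (⊆-antisym P⊆Q Q⊆P) P≢Q
  where
  Q⊆P : Q ⊆ P
  Q⊆P {z} z∈Q = decidable-stable (z ∈? P) (λ z∉P → ∄z (z , z∈Q , z∉P))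

module _ {n : ℕ} where

  Compatible : Subset n → Subset n → Set
  Compatible P Q = (P ∩ Q ≡ P) ⊎ (P ∩ Q ≡ Q) ⊎ (P ∩ Q ≡ S.⊥)

  compatible-sym : ∀ {P Q} → Compatible P Q → Compatible Q P
  compatible-sym {P} {Q} (inj₁ e)        = inj₂ (inj₁ (trans (∩-comm Q P) e))
  compatible-sym {P} {Q} (inj₂ (inj₁ e)) = inj₁ (trans (∩-comm Q P) e)
  compatible-sym {P} {Q} (inj₂ (inj₂ e)) = inj₂ (inj₂ (trans (∩-comm Q P) e))

  ⊆⇒compatible : ∀ {P Q} → P ⊆ Q → Compatible P Q
  ⊆⇒compatible {P} {Q} P⊆Q = inj₁ (⊆-antisym (p∩q⊆p P Q) (λ z∈P → x∈p∩q⁺ (z∈P , P⊆Q z∈P)))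

  compatible-⁅⁆ : ∀ a Q → Compatible ⁅ a ⁆ Q
  compatible-⁅⁆ a Q with a ∈? Q
  ... | yes a∈Q = ⊆⇒compatible (λ z∈⁅a⁆ → subst (_∈ Q) (sym (x∈⁅y⁆⇒x≡y a z∈⁅a⁆)) a∈Q)
  ... | no a∉Q  = inj₂ (inj₂ (⊆-antisym ⁅a⁆∩Q⊆⊥ ⊥⊆))
    where
    ⁅a⁆∩Q⊆⊥ : ⁅ a ⁆ ∩ Q ⊆ S.⊥
    ⁅a⁆∩Q⊆⊥ z∈ with x∈⁅y⁆⇒x≡y a (p∩q⊆p ⁅ a ⁆ Q z∈)
    ... | refl = contradiction (p∩q⊆q ⁅ a ⁆ Q z∈) a∉Q

  compatible⇒nested : ∀ {P Q z} → Compatible P Q → z ∈ P → z ∈ Q → P ⊆ Q ⊎ Q ⊆ P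
  compatible⇒nested {P} {Q} (inj₁ e)        _   _   = inj₁ (⊆-trans (⊆-reflexive (sym e)) (p∩q⊆q P Q))
  compatible⇒nested {P} {Q} (inj₂ (inj₁ e)) _   _   = inj₂ (⊆-trans (⊆-reflexive (sym e)) (p∩q⊆p P Q))
  compatible⇒nested {P} {Q} (inj₂ (inj₂ e)) z∈P z∈Q = contradiction (subst (_ ∈_) e (x∈p∩q⁺ (z∈P , z∈Q))) ∉⊥

  WithTrivialClusters : (Subset n → Set) → Subset n → Set
  WithTrivialClusters F C = F C ⊎ C ≡ ⊤ ⊎ ∃[ x ] C ≡ ⁅ x ⁆

  hierarchyLike-withTrivialClusters : ∀ {F} → HierarchyLike F → HierarchyLike (WithTrivialClusters F)
  hierarchyLike-withTrivialClusters H P Q (inj₁ FP) (inj₁ FQ) = H P Q FP FQ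
  hierarchyLike-withTrivialClusters H P Q (inj₂ (inj₁ refl)) _ = compatible-sym (⊆⇒compatible λ _ → ∈⊤)
  hierarchyLike-withTrivialClusters H P Q _ (inj₂ (inj₁ refl)) = ⊆⇒compatible λ _ → ∈⊤
  hierarchyLike-withTrivialClusters H P Q (inj₂ (inj₂ (a , refl))) _ = compatible-⁅⁆ a Q
  hierarchyLike-withTrivialClusters H P Q _ (inj₂ (inj₂ (a , refl))) = compatible-sym (compatible-⁅⁆ a P)

  module _ {F : Subset n → Set} (H : HierarchyLike F) (x y : Fin n) where

    CommonCluster : Subset n → Set
    CommonCluster L = F L × x ∈ L × y ∈ L

    LowerBound : Subset n → Subset n → Set
    LowerBound L P = x ∈ P → y ∈ P → L ⊆ P

    lowerBound-⊆ : ∀ {K L P} → K ⊆ L → LowerBound L P → LowerBound K P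
    lowerBound-⊆ K⊆L L≤P x∈P y∈P = ⊆-trans K⊆L (L≤P x∈P y∈P)

    lowestCommonCluster : ∀ {I : Set} (P : I → Subset n) → (∀ i → F (P i)) → (is : List I) →
      ∀ {L} → CommonCluster L →
      ∃[ L′ ] (CommonCluster L′ × All (LowerBound L′ ∘ P) is)
    lowestCommonCluster P FP [] common = _ , common , []
    lowestCommonCluster P FP (i ∷ is) common
      with lowestCommonCluster P FP is common | x ∈? P i | y ∈? P i
    ... | L′ , common′ , below | no x∉Pi | _ = L′ , common′ , (λ x∈Pi _ → contradiction x∈Pi x∉Pi) ∷ below
    ... | L′ , common′ , below | yes _ | no y∉Pi = L′ , common′ , (λ _ y∈Pi → contradiction y∈Pi y∉Pi) ∷ below
    ... | L′ , common′@(FL′ , x∈L′ , _) , below | yes x∈Pi | yes y∈Pi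
      with compatible⇒nested (H _ _ FL′ (FP i)) x∈L′ x∈Pi
    ...   | inj₁ L′⊆Pi = L′ , common′ , (λ _ _ → L′⊆Pi) ∷ below
    ...   | inj₂ Pi⊆L′ = P i , (FP i , x∈Pi , y∈Pi) ,
                         (λ _ _ → ⊆-refl) ∷ All.map (lowerBound-⊆ Pi⊆L′) below

module _ {n k : ℕ} (ε : EpsMap n k) where

  private
    X : Set
    X = Fin (suc n)

    Colour : Set
    Colour = Fin (suc k)

    N-entry : Colour → X → X → Bool
    N-entry m y z = if ⌊ z ≟ y ⌋ then true else not (lookup (ε z y) m)

  y∈N[y] : ∀ m y → y ∈ N ε m y
  y∈N[y] m y = lookup⇒[]= y _ (trans (lookup∘tabulate (N-entry m y) y) y-entry)
    where
    y-entry : N-entry m y y ≡ true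
    y-entry with y ≟ y
    ... | yes _   = refl
    ... | no y≢y = contradiction refl y≢y

  lookup-N : ∀ {m x y} → x ≢ y → lookup (N ε m y) x ≡ not (lookup (ε x y) m)
  lookup-N {m} {x} {y} x≢y = trans (lookup∘tabulate (N-entry m y) x) x-entry
    where
    x-entry : N-entry m y x ≡ not (lookup (ε x y) m)
    x-entry with x ≟ y
    ... | yes x≡y = contradiction x≡y x≢y
    ... | no _    = refl

  ∈-N⁺ : ∀ {m x y} → x ≢ y → m ∉ ε x y → x ∈ N ε m y
  ∈-N⁺ {m} {x} {y} x≢y m∉ε with lookup (ε x y) m in eq
  ... | true  = contradiction (lookup⇒[]= m (ε x y) eq) m∉ε
  ... | false = lookup⇒[]= x (N ε m y) (trans (lookup-N x≢y) (cong not eq))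

  ∈-N⁻ : ∀ {m x y} → x ≢ y → x ∈ N ε m y → m ∉ ε x y
  ∈-N⁻ x≢y x∈N m∈ε =
    contradiction (trans (sym ([]=⇒lookup x∈N)) (trans (lookup-N x≢y) (cong not ([]=⇒lookup m∈ε)))) λ ()

  εTree-isPhyloTree : HierarchyLike (NSys ε) → IsPhyloTree (εTree ε)
  εTree-isPhyloTree H =
    hierarchyLike-withTrivialClusters H , nonempty , inj₂ (inj₁ refl) , λ x → inj₂ (inj₂ (x , refl))
    where
    nonempty : ∀ C → Cl (εTree ε) C → Nonempty C
    nonempty _ (inj₁ (y , m , refl))     = y , y∈N[y] m y
    nonempty _ (inj₂ (inj₁ refl))        = zero , ∈⊤
    nonempty _ (inj₂ (inj₂ (x , refl))) = x , x∈⁅x⁆ x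

  εTree-lca : HierarchyLike (NSys ε) → ∀ {x y} → x ≢ y → ∃ (IsLca (εTree ε) x y)
  εTree-lca H {x} {y} x≢y
    with lowestCommonCluster (hierarchyLike-withTrivialClusters H) x y
           (λ (y′ , m) → N ε m y′) (λ (y′ , m) → inj₁ (y′ , m , refl))
           (cartesianProduct (allFin _) (allFin _)) (inj₂ (inj₁ refl) , ∈⊤ , ∈⊤)
  ... | L , (CL , x∈L , y∈L) , below = L , CL , x∈L , y∈L , minimal
    where
    minimal : ∀ C → Cl (εTree ε) C → x ∈ C → y ∈ C → L ⊆ C
    minimal _ (inj₁ (y′ , m , refl))     = All.lookup below (∈-cartesianProduct⁺ (∈-allFin y′) (∈-allFin m))
    minimal _ (inj₂ (inj₁ refl)) _ _ _   = ∈⊤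
    minimal _ (inj₂ (inj₂ (z , refl))) x∈⁅z⁆ y∈⁅z⁆ =
      contradiction (trans (x∈⁅y⁆⇒x≡y z x∈⁅z⁆) (sym (x∈⁅y⁆⇒x≡y z y∈⁅z⁆))) x≢y

  εTree-explains : HierarchyLike (NSys ε) →
    (∀ y m y′ → y′ ∈ N ε m y → ∣ N ε m y′ ∣ ≤ ∣ N ε m y ∣) →
    Explains (εTree ε) ε
  εTree-explains H shrink x y x≢y m with εTree-lca H x≢y
  ... | L , lca@(CL , x∈L , y∈L , minimal) = L , lca , mk⇔ m∈ε⇒m-edge-on-path m-edge-on-path⇒m∈ε
    where
    MEdgeOnPath : Set
    MEdgeOnPath = ∃[ C ] (Cl (εTree ε) C × y ∈ C × C ⊆ L × C ≢ L × Lab (εTree ε) C m)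

    m∈ε⇒m-edge-on-path : m ∈ ε x y → MEdgeOnPath
    m∈ε⇒m-edge-on-path m∈ε = N ε m y , inj₁ (y , m , refl) , y∈N[y] m y , N⊆L , N≢L , (y , refl)
      where
      x∉N : x ∉ N ε m y
      x∉N x∈N = ∈-N⁻ x≢y x∈N m∈ε

      N⊆L : N ε m y ⊆ L
      N⊆L with compatible⇒nested (hierarchyLike-withTrivialClusters H _ _ CL (inj₁ (y , m , refl)))
                                 y∈L (y∈N[y] m y)
      ... | inj₁ L⊆N = contradiction (L⊆N x∈L) x∉N
      ... | inj₂ N⊆L = N⊆L

      N≢L : N ε m y ≢ L
      N≢L N≡L = x∉N (subst (x ∈_) (sym N≡L) x∈L)

    m-edge-on-path⇒m∈ε : MEdgeOnPath → m ∈ ε x y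
    m-edge-on-path⇒m∈ε (_ , _ , y∈C , C⊆L , C≢L , y′ , refl) = decidable-stable (m ∈? ε x y) λ m∉ε →
      <-irrefl refl (begin-strict
        ∣ N ε m y′ ∣ <⟨ p⊂q⇒∣p∣<∣q∣ (⊆∧≢⇒⊂ C⊆L C≢L) ⟩
        ∣ L ∣        ≤⟨ p⊆q⇒∣p∣≤∣q∣ (minimal _ (inj₁ (y , m , refl)) (∈-N⁺ x≢y m∉ε) (y∈N[y] m y)) ⟩
        ∣ N ε m y ∣  ≤⟨ shrink y′ m y y∈C ⟩
        ∣ N ε m y′ ∣ ∎)
      where open ≤-Reasoning

lemma2 : ∀ {n k} (ε : EpsMap n k) →
    HierarchyLike (NSys ε) →
    (∀ y m y′ → y′ ∈ N ε m y → ∣ N ε m y′ ∣ ≤ ∣ N ε m y ∣) →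
    IsFitch ε × (IsPhyloTree (εTree ε) × Explains (εTree ε) ε)
lemma2 ε H shrink = (εTree ε , isPhyloTree , explains) , isPhyloTree , explains
  where
  isPhyloTree : IsPhyloTree (εTree ε)
  isPhyloTree = εTree-isPhyloTree ε H

  explains : Explains (εTree ε) ε
  explains = εTree-explains ε H shrink
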